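{- Let $M$ be a non-oriented map with $n$ edges and $\prec$ a history on $M$; let $E_1,\dots,E_n$ be the edges listed according to $\prec$ and $M_i=M\setminus\{E_1,\dots,E_i\}$ for $0\le i\le n$. Then the following are equivalent: (A) each of the maps $M_0,M_1,\dots,M_n$ is a top-degree map; (B) for each $0\le i\le n-1$, the edge $E_{i+1}$ of the map $M_i$ is either a twisted edge, or a bridge or a leaf of $M_i$.
   Context: A non-oriented map is a bicolored graph (edges join black and white vertices, no isolated vertices) embedded in a possibly disconnected, possibly non-orientable closed surface so that each face (component of the complement) is an open disc; equivalently, a ribbon graph. $M\setminus E$ denotes the map obtained by removing the edge (ribbon) $E$ and also removing any vertex that becomes isolated; the surface is the one determined by the resulting ribbon graph. A history on $M$ is a linear order on its set of edges. A map is top-degree if each of its connected components has exactly one face (i.e. each component is one face); the empty map is top-degree. Each edge has two edge-sides; traversing the boundary of a face one traverses edge-sides. An edge $E$ is twisted if both its sides lie on the boundary of the same face and, traveling along the boundary of that face, $E$ is traversed twice in the same direction; straight if both sides lie on the same face and it is traversed twice in opposite directions; interface if its two sides lie on two different faces. A bridge is an edge whose removal increases the number of connected components; a leaf is an edge one of whose endpoints has degree $1$. -}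

module Defs where

-- Combinatorial encoding of (bicoloured) non-oriented maps / ribbon graphs
-- following Goulden–Jackson: every edge e has two edge-sides (e , false) and
-- (e , true); ε swaps the two sides of an edge; β (resp. ω) is a
-- fixed-point-free involution on edge-sides pairing consecutive edge-sides
-- around the black (resp. white) vertices (i.e. the corners at black/white
-- vertices).  Black vertices = orbits of ⟨ε,β⟩, white vertices = orbits of
-- ⟨ε,ω⟩, faces = orbits of ⟨β,ω⟩ (a face boundary is traversed as an
-- alternating sequence of edge-sides glued at white and black corners),
-- connected components = orbits of ⟨ε,β,ω⟩.
--
-- To make edge deletion simple, a map lives on the edge labels Fin n together
-- with a predicate 'present' telling which labels are (still) edges of the map;
-- data on absent labels is irrelevant junk.

open import Data.Nat using (ℕ; _<_)
open import Data.Fin using (Fin; _≟_)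
open import Data.Bool using (Bool; true; false; not; _∧_; if_then_else_)
open import Data.Product using (_×_; _,_; proj₁; proj₂; Σ; ∃₂)
open import Data.Sum using (_⊎_)
open import Data.List using (List; foldl; take; tabulate)
open import Relation.Binary.PropositionalEquality using (_≡_; _≢_)
open import Relation.Binary.Construct.Closure.ReflexiveTransitive using (Star)
open import Relation.Nullary using (does)
open import Function using (flip)
open import Function.Bundles using (_⇔_; _⤖_; Bijection)

Side : ℕ → Set
Side n = Fin n × Bool

ε : ∀ {n} → Side n → Side n
ε (e , b) = (e , not b)

record PMap (n : ℕ) : Set where
  field
    present : Fin n → Bool
    β       : Side n → Side n
    ω       : Side n → Side n
open PMap public

module _ {n : ℕ} (M : PMap n) where

  Present : Side n → Set
  Present s = present M (proj₁ s) ≡ true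

  IsMap : Set
  IsMap = ∀ s → Present s →
      (Present (β M s) × β M (β M s) ≡ s × β M s ≢ s)
    × (Present (ω M s) × ω M (ω M s) ≡ s × ω M s ≢ s)

  -- all labels in Fin n are edges: a map with exactly n edges
  AllPresent : Set
  AllPresent = ∀ e → present M e ≡ true

  data CStep (s t : Side n) : Set where
    viaε : Present s → t ≡ ε s     → CStep s t
    viaβ : Present s → t ≡ β M s   → CStep s t
    viaω : Present s → t ≡ ω M s   → CStep s t

  Connected : Side n → Side n → Set
  Connected = Star CStep

  data FStep (s t : Side n) : Set where
    fβ : Present s → t ≡ β M s → FStep s t
    fω : Present s → t ≡ ω M s → FStep s t

  SameFace : Side n → Side n → Set
  SameFace = Star FStep

  -- top-degree: every connected component has exactly one face, i.e. any two
  -- edge-sides of the same component lie on the same face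
  TopDegree : Set
  TopDegree = ∀ s t → Present s → Present t → Connected s t → SameFace s t

  -- A state (s , true) means the
  -- edge-side s is traversed from its black end to its white end (it was
  -- entered at a black corner, and is left through the white corner ω);
  -- (s , false) means it is traversed from white to black.
  data TStep : Side n × Bool → Side n × Bool → Set where
    tω : ∀ {s} → Present s → TStep (s , true)  (ω M s , false)
    tβ : ∀ {s} → Present s → TStep (s , false) (β M s , true)

  -- E is twisted: both sides lie on the same face, and walking along the
  -- boundary of that face both sides are traversed in the same direction
  Twisted : Fin n → Set
  Twisted e = Star TStep ((e , false) , true) ((e , true) , true)

  Components : ℕ → Set
  Components k = Σ (Side n → Fin k) λ c →
      (∀ s t → Present s → Present t → (c s ≡ c t ⇔ Connected s t))
    × (∀ j → Σ (Side n) λ s → Present s × c s ≡ j)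

  -- an endpoint of E has degree 1: the black (resp. white) vertex cycle
  -- through the sides of E has length 2, i.e. β (resp. ω) swaps the two
  -- sides of E
  Leaf : Fin n → Set
  Leaf e = β M (e , false) ≡ (e , true) ⊎ ω M (e , false) ≡ (e , true)

-- M ∖ E : remove the edge e; around each endpoint the corners on both sides
-- of e are merged (if e was the only edge at a vertex, that vertex disappears,
-- since its sides are no longer present)
delete : ∀ {n} → PMap n → Fin n → PMap n
delete M e = record
  { present = λ e′ → present M e′ ∧ not (does (e′ ≟ e))
  ; β = λ s → if does (proj₁ (β M s) ≟ e) then β M (ε (β M s)) else β M s
  ; ω = λ s → if does (proj₁ (ω M s) ≟ e) then ω M (ε (ω M s)) else ω M s
  }

Bridge : ∀ {n} → PMap n → Fin n → Set
Bridge M e = ∃₂ λ k k′ → Components M k × Components (delete M e) k′ × k < k′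

-- a history is a linear order on the edges, given as the listing
-- E₁ , … , Eₙ  (E_{i+1} = Bijection.to h i);  M_i = M ∖ {E₁,…,E_i}
stage : ∀ {n} → PMap n → (Fin n ⤖ Fin n) → ℕ → PMap n
stage {n} M h i = foldl delete M (take i (tabulate {n = n} (Bijection.to h)))

module Submission where

open import Defs
open import Data.Nat using (ℕ; zero; suc; _+_; _∸_; _*_; _≤_; _<_; z≤n; s≤s; ≢-nonZero)
import Data.Nat.Properties as ℕ
open import Data.Fin as Fin using (Fin; toℕ; combine; fromℕ; inject₁)
import Data.Fin.Properties as Fin
open import Data.Fin.Relation.Unary.Top using (view; ‵fromℕ; ‵inject₁)
open import Data.Bool using (Bool; true; false; not; if_then_else_)
import Data.Bool.Properties as Bool
open import Data.List using (List; []; _∷_; length; lookup; map; foldl; take; tabulate)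
import Data.List.Properties as List
open import Data.List.Membership.Propositional using (_∈_; _∉_)
open import Data.List.Membership.Propositional.Properties using (∈-lookup; ∈-map⁺; ∈-tabulate⁺)
open import Data.List.Relation.Unary.All as All using (All; []; _∷_)
open import Data.List.Relation.Unary.All.Properties using (¬Any⇒All¬)
open import Data.List.Relation.Unary.AllPairs using (AllPairs; []; _∷_)
open import Data.List.Relation.Unary.Any as Any using (Any; here; there; any?)
open import Data.List.Relation.Unary.Any.Properties using (lookup-index)
open import Data.Product using (Σ; _×_; _,_; proj₁; proj₂)
import Data.Product.Properties as Product
open import Data.Sum using (_⊎_; inj₁; inj₂)
open import Data.Empty using (⊥; ⊥-elim)
open import Relation.Nullary using (¬_; Dec; yes; no; does)
open import Relation.Unary using (Decidable)
open import Relation.Binary.Definitions using (DecidableEquality)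
open import Relation.Binary.PropositionalEquality
open import Relation.Binary.Construct.Closure.ReflexiveTransitive using (Star; _◅_; _◅◅_) renaming (ε to [])
open import Function.Bundles using (_⇔_; mk⇔; _⤖_; Bijection; Equivalence)
open Equivalence using (to; from)

-- Everything reduces to one removal (EdgeRemoval.removal-step): if N ∖ e is
-- top-degree, then N is top-degree iff e is twisted, a bridge or a leaf.
-- (⇐) Such an e has both sides on one face (a leaf or a twisted edge
--     directly, a bridge because otherwise the corners of e would stay joined
--     in N ∖ e and no component would be gained), and then all face walks and
--     connections of N ∖ e lift to N around e (top-degree-lift).
-- (⇒) Otherwise the face of (e , false) meets (e , true) in the opposite
--     direction, and splits in N ∖ e into two faces through the two corners
--     w₀ , b₀ of e; as N ∖ e is top-degree they lie in different components,
--     one of them new, so e is a bridge (ForcedBridge).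

Classification : (A : Set) → (A → Set) → (A → A → Set) → ℕ → Set
Classification A P R k = Σ (A → Fin k) λ c →
    (∀ s t → P s → P t → (c s ≡ c t ⇔ R s t))
  × (∀ j → Σ A λ s → P s × c s ≡ j)

module FiniteClassification
  {A : Set} (P : A → Set) (P? : Decidable P)
  (R : A → A → Set) (R? : ∀ a b → P a → Dec (R a b))
  (R-refl : ∀ a → R a a) (R-sym : ∀ {a b} → R a b → R b a)
  (R-trans : ∀ {a b c} → R a b → R b c → R a c) where

  Unrelated : A → A → Set
  Unrelated a b = ¬ R a b

  record Representatives (xs : List A) : Set where
    field
      reps      : List A
      reps-P    : All P reps
      separated : AllPairs Unrelated reps
      covers    : ∀ {a} → a ∈ xs → P a → Any (R a) reps

  representatives : ∀ xs → Representatives xs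
  representatives [] = record { reps = [] ; reps-P = [] ; separated = [] ; covers = λ () }
  representatives (x ∷ xs) with representatives xs
  ... | record { reps = rs ; reps-P = rs-P ; separated = sep ; covers = cov } with P? x
  ...   | no ¬px = record { reps = rs ; reps-P = rs-P ; separated = sep ; covers = cov′ }
    where
      cov′ : ∀ {a} → a ∈ x ∷ xs → P a → Any (R a) rs
      cov′ (here refl) pa = ⊥-elim (¬px pa)
      cov′ (there a∈) pa = cov a∈ pa
  ...   | yes px with any? (λ r → R? x r px) rs
  ...     | yes x~rs = record { reps = rs ; reps-P = rs-P ; separated = sep ; covers = cov′ }
    where
      cov′ : ∀ {a} → a ∈ x ∷ xs → P a → Any (R a) rs
      cov′ (here refl) pa = x~rs
      cov′ (there a∈) pa = cov a∈ pa
  ...     | no x≁rs = record { reps = x ∷ rs ; reps-P = px ∷ rs-P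
                             ; separated = ¬Any⇒All¬ rs x≁rs ∷ sep ; covers = cov′ }
    where
      cov′ : ∀ {a} → a ∈ x ∷ xs → P a → Any (R a) (x ∷ rs)
      cov′ (here refl) pa = here (R-refl x)
      cov′ (there a∈) pa = there (cov a∈ pa)

  index-unique : ∀ {a b rs} → AllPairs Unrelated rs → R a b →
    (w : Any (R a) rs) (w′ : Any (R b) rs) → Any.index w ≡ Any.index w′
  index-unique _ _ (here _) (here _) = refl
  index-unique (sep ∷ _) ab (here r) (there w′) =
    ⊥-elim (proj₁ (All.lookupAny sep w′) (R-trans (R-sym r) (R-trans ab (proj₂ (All.lookupAny sep w′)))))
  index-unique (sep ∷ _) ab (there w) (here r′) =
    ⊥-elim (proj₁ (All.lookupAny sep w) (R-trans (R-sym r′) (R-trans (R-sym ab) (proj₂ (All.lookupAny sep w)))))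
  index-unique (_ ∷ seps) ab (there w) (there w′) = cong Fin.suc (index-unique seps ab w w′)

  self-witness : ∀ rs (j : Fin (length rs)) → Σ (Any (R (lookup rs j)) rs) λ w → Any.index w ≡ j
  self-witness (r ∷ rs) Fin.zero = here (R-refl r) , refl
  self-witness (r ∷ rs) (Fin.suc j) with self-witness rs j
  ... | w , w-j = there w , cong Fin.suc w-j

  -- label each P-element by the position of its representative (a₀ only
  -- provides a label for the junk outside P)
  classify : (xs : List A) → (∀ a → P a → a ∈ xs) → (a₀ : A) → P a₀ → Σ ℕ (Classification A P R)
  classify xs complete a₀ pa₀ = length reps , label , fibres , onto
    where
      open Representatives (representatives xs)

      witness : ∀ {a} → P a → Any (R a) reps
      witness {a} pa = covers (complete a pa) pa

      label : A → Fin (length reps)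
      label a with P? a
      ... | yes pa = Any.index (witness pa)
      ... | no _ = Any.index (witness pa₀)

      label-witness : ∀ {a} (pa : P a) (w : Any (R a) reps) → label a ≡ Any.index w
      label-witness {a} pa w with P? a
      ... | yes pa′ = index-unique separated (R-refl a) (witness pa′) w
      ... | no ¬pa = ⊥-elim (¬pa pa)

      fibres : ∀ s t → P s → P t → (label s ≡ label t ⇔ R s t)
      fibres s t ps pt = mk⇔ same-label⇒R R⇒same-label
        where
          same-label⇒R : label s ≡ label t → R s t
          same-label⇒R eq =
            R-trans (lookup-index (witness ps))
              (R-sym (subst (λ i → R t (lookup reps i)) index-eq (lookup-index (witness pt))))
            where
              index-eq : Any.index (witness pt) ≡ Any.index (witness ps)
              index-eq = trans (sym (label-witness pt (witness pt)))
                               (trans (sym eq) (label-witness ps (witness ps)))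
          R⇒same-label : R s t → label s ≡ label t
          R⇒same-label st = trans (label-witness ps (witness ps))
            (trans (index-unique separated st (witness ps) (witness pt)) (sym (label-witness pt (witness pt))))

      onto : ∀ j → Σ A λ s → P s × label s ≡ j
      onto j = lookup reps j , All.lookup reps-P (∈-lookup j)
             , trans (label-witness (All.lookup reps-P (∈-lookup j)) (proj₁ (self-witness reps j))) (proj₂ (self-witness reps j))

module SplitOffClass
  {A : Set} (P P′ : A → Set) (P′? : Decidable P′) (P′⇒P : ∀ {s} → P′ s → P s)
  (R R′ : A → A → Set) (R′⇒R : ∀ {s t} → R′ s t → R s t) (R-sym : ∀ {a b} → R a b → R b a)
  (R′-sym : ∀ {a b} → R′ a b → R′ b a) (R′-trans : ∀ {a b c} → R′ a b → R′ b c → R′ a c)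
  (w : A) (P′w : P′ w) (R′-refl-w : R′ w w) (near-w? : ∀ s → P′ s → Dec (R′ s w))
  (R⇒R′-away : ∀ {s t} → P′ s → P′ t → ¬ R′ s w → ¬ R′ t w → R s t → R′ s t)
  (away-rep : ∀ {s} → P s → Σ A λ t → P′ t × ¬ R′ t w × R s t)
  where

  split-off : ∀ {k} → Classification A P R k → Classification A P′ R′ (suc k)
  split-off {k} (c , fibres , onto) = label , fibres′ , onto′
    where
      label : A → Fin (suc k)
      label s with P′? s
      ... | no _ = inject₁ (c s)
      ... | yes p with near-w? s p
      ...   | yes _ = fromℕ k
      ...   | no _ = inject₁ (c s)

      label-near : ∀ {s} → P′ s → R′ s w → label s ≡ fromℕ k
      label-near {s} p sw with P′? s
      ... | no ¬p = ⊥-elim (¬p p)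
      ... | yes p′ with near-w? s p′
      ...   | yes _ = refl
      ...   | no ¬sw = ⊥-elim (¬sw sw)

      label-away : ∀ {s} → P′ s → ¬ R′ s w → label s ≡ inject₁ (c s)
      label-away {s} p ¬sw with P′? s
      ... | no _ = refl
      ... | yes p′ with near-w? s p′
      ...   | yes sw = ⊥-elim (¬sw sw)
      ...   | no _ = refl

      fibres′ : ∀ s t → P′ s → P′ t → (label s ≡ label t ⇔ R′ s t)
      fibres′ s t ps pt with near-w? s ps | near-w? t pt
      ... | yes sw | yes tw = mk⇔ (λ _ → R′-trans sw (R′-sym tw)) (λ _ → trans (label-near ps sw) (sym (label-near pt tw)))
      ... | yes sw | no ¬tw = mk⇔ (λ eq → ⊥-elim (Fin.fromℕ≢inject₁ (trans (sym (label-near ps sw)) (trans eq (label-away pt ¬tw)))))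
                                  (λ st → ⊥-elim (¬tw (R′-trans (R′-sym st) sw)))
      ... | no ¬sw | yes tw = mk⇔ (λ eq → ⊥-elim (Fin.fromℕ≢inject₁ (trans (sym (label-near pt tw)) (trans (sym eq) (label-away ps ¬sw)))))
                                  (λ st → ⊥-elim (¬sw (R′-trans st tw)))
      ... | no ¬sw | no ¬tw = mk⇔
            (λ eq → R⇒R′-away ps pt ¬sw ¬tw (fibres s t (P′⇒P ps) (P′⇒P pt) .to
                      (Fin.inject₁-injective (trans (sym (label-away ps ¬sw)) (trans eq (label-away pt ¬tw))))))
            (λ st → trans (label-away ps ¬sw) (trans (cong inject₁ (fibres s t (P′⇒P ps) (P′⇒P pt) .from (R′⇒R st)))
                      (sym (label-away pt ¬tw))))

      onto′ : ∀ j → Σ A λ s → P′ s × label s ≡ j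
      onto′ j with view j
      ... | ‵fromℕ = w , P′w , label-near P′w R′-refl-w
      ... | ‵inject₁ i with onto i
      ...   | s , ps , cs≡i with away-rep ps
      ...     | t , pt , ¬tw , st = t , pt , trans (label-away pt ¬tw)
                                      (cong inject₁ (trans (fibres t s (P′⇒P pt) ps .from (R-sym st)) cs≡i))

fewer-classes : ∀ {A : Set} {P P′ : A → Set} {R R′ : A → A → Set} {k k′} →
  (∀ {s} → P′ s → P s) → (∀ {s t} → P′ s → P′ t → R s t → R′ s t) →
  Classification A P R k → Classification A P′ R′ k′ → k′ ≤ k
fewer-classes P′⇒P R⇒R′ (c , fibres , _) (c′ , fibres′ , onto′) = Fin.injective⇒≤ old-class-injective
  where
    -- the old class of a representative of a new class
    old-class-injective : ∀ {i j} → c (proj₁ (onto′ i)) ≡ c (proj₁ (onto′ j)) → i ≡ j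
    old-class-injective {i} {j} eq with onto′ i | onto′ j
    ... | s , ps , refl | t , pt , refl = fibres′ s t ps pt .from (R⇒R′ ps pt (fibres s t (P′⇒P ps) (P′⇒P pt) .to eq))

least : (Q : ℕ → Set) → (∀ i → Dec (Q i)) → ∀ b → Q b →
        Σ ℕ λ m → m ≤ b × Q m × (∀ j → j < m → ¬ Q j)
least Q Q? zero q = 0 , z≤n , q , λ j ()
least Q Q? (suc b) q with Q? 0
... | yes q₀ = 0 , z≤n , q₀ , λ j ()
... | no ¬q₀ with least (λ i → Q (suc i)) (λ i → Q? (suc i)) b q
...   | m , m≤b , qm , below = suc m , s≤s m≤b , qm , below′
  where
    below′ : ∀ j → j < suc m → ¬ Q j
    below′ zero _ = ¬q₀
    below′ (suc j) (s≤s j<m) = below j j<m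

parity : ∀ l → Σ ℕ λ k → l ≡ k + k ⊎ l ≡ suc (k + k)
parity zero = 0 , inj₁ refl
parity (suc l) with parity l
... | k , inj₁ even = k , inj₂ (cong suc even)
... | k , inj₂ odd = suc k , inj₁ (trans (cong suc odd) (cong suc (sym (ℕ.+-suc k k))))

side≟ : ∀ {n} → DecidableEquality (Side n)
side≟ = Product.≡-dec Fin._≟_ Bool._≟_

ε-involutive : ∀ {n} (s : Side n) → ε (ε s) ≡ s
ε-involutive (e , b) = cong (e ,_) (Bool.not-involutive b)

ε-not-fixed : ∀ {n} (s : Side n) → ε s ≢ s
ε-not-fixed (e , true) ()
ε-not-fixed (e , false) ()

same-edge : ∀ {n} {a b : Side n} → proj₁ a ≡ proj₁ b → a ≡ b ⊎ a ≡ ε b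
same-edge {a = e , true} {b = .e , true} refl = inj₁ refl
same-edge {a = e , false} {b = .e , false} refl = inj₁ refl
same-edge {a = e , true} {b = .e , false} refl = inj₂ refl
same-edge {a = e , false} {b = .e , true} refl = inj₂ refl

allSides : ∀ n → List (Side n)
allSides zero = []
allSides (suc n) = (Fin.zero , false) ∷ (Fin.zero , true) ∷ map (λ s → (Fin.suc (proj₁ s) , proj₂ s)) (allSides n)

allSides-complete : ∀ {n} (s : Side n) → s ∈ allSides n
allSides-complete {suc n} (Fin.zero , false) = here refl
allSides-complete {suc n} (Fin.zero , true) = there (here refl)
allSides-complete {suc n} (Fin.suc e , b) =
  there (there (∈-map⁺ (λ s → (Fin.suc (proj₁ s) , proj₂ s)) (allSides-complete (e , b))))

DSide : ℕ → Set
DSide n = Side n × Bool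

dside≟ : ∀ {n} → DecidableEquality (DSide n)
dside≟ = Product.≡-dec side≟ Bool._≟_

reverse : ∀ {n} → DSide n → DSide n
reverse (s , d) = (s , not d)

-- an injective encoding into a finite set, for the pigeonhole principle
bit : Bool → Fin 2
bit false = Fin.zero
bit true = Fin.suc Fin.zero

bit-injective : ∀ {a b} → bit a ≡ bit b → a ≡ b
bit-injective {false} {false} _ = refl
bit-injective {true} {true} _ = refl

encode : ∀ {n} → DSide n → Fin (n * 2 * 2)
encode ((e , b) , d) = combine (combine e (bit b)) (bit d)

encode-injective : ∀ {n} (x y : DSide n) → encode x ≡ encode y → x ≡ y
encode-injective ((e , b) , d) ((e′ , b′) , d′) eq
  with outer-side , outer-dir ← Fin.combine-injective (combine e (bit b)) (bit d) (combine e′ (bit b′)) (bit d′) eq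
  with refl , inner-side ← Fin.combine-injective e (bit b) e′ (bit b′) outer-side
  rewrite bit-injective outer-dir | bit-injective inner-side = refl

record Involution {n} (N : PMap n) (g : Side n → Side n) : Set where
  field
    keeps-present    : ∀ {s} → Present N s → Present N (g s)
    involutive       : ∀ {s} → Present N s → g (g s) ≡ s
    fixed-point-free : ∀ {s} → Present N s → g s ≢ s

β-involution : ∀ {n} (N : PMap n) → IsMap N → Involution N (β N)
β-involution N isM = record
  { keeps-present = λ p → proj₁ (proj₁ (isM _ p))
  ; involutive = λ p → proj₁ (proj₂ (proj₁ (isM _ p)))
  ; fixed-point-free = λ p → proj₂ (proj₂ (proj₁ (isM _ p))) }

ω-involution : ∀ {n} (N : PMap n) → IsMap N → Involution N (ω N)
ω-involution N isM = record
  { keeps-present = λ p → proj₁ (proj₂ (isM _ p))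
  ; involutive = λ p → proj₁ (proj₂ (proj₂ (isM _ p)))
  ; fixed-point-free = λ p → proj₂ (proj₂ (proj₂ (isM _ p))) }

present? : ∀ {n} (N : PMap n) s → Dec (Present N s)
present? N s = present N (proj₁ s) Bool.≟ true

-- The faces of a map N: the face boundaries are the orbits of the
-- permutation 'next' of directed sides (leave through the white corner ω
-- after a black-to-white traversal, through the black corner β after a
-- white-to-black one).
module Faces {n : ℕ} (N : PMap n) (isM : IsMap N) where

  open Involution (β-involution N isM) public
    renaming (keeps-present to β-present; involutive to β-involutive; fixed-point-free to β-not-fixed)
  open Involution (ω-involution N isM) public
    renaming (keeps-present to ω-present; involutive to ω-involutive; fixed-point-free to ω-not-fixed)

  ε-present : ∀ {s} → Present N s → Present N (ε s)
  ε-present {_ , _} p = p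

  -- a directed side of a present side (a record, so that x can be inferred)
  record Live (x : DSide n) : Set where
    constructor live
    field present-side : Present N (proj₁ x)
  open Live public

  next : DSide n → DSide n
  next (s , true) = (ω N s , false)
  next (s , false) = (β N s , true)

  walk : ℕ → DSide n → DSide n
  walk zero x = x
  walk (suc i) x = next (walk i x)

  next-step : ∀ {x} → Live x → TStep N x (next x)
  next-step {s , true} (live p) = tω p
  next-step {s , false} (live p) = tβ p

  next-live : ∀ {x} → Live x → Live (next x)
  next-live {s , true} (live p) = live (ω-present p)
  next-live {s , false} (live p) = live (β-present p)

  next-injective : ∀ {x y} → Live x → Live y → next x ≡ next y → x ≡ y
  next-injective {s , true} {t , true} (live p) (live q) eq =
    cong (_, true) (trans (sym (ω-involutive p)) (trans (cong (λ z → ω N (proj₁ z)) eq) (ω-involutive q)))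
  next-injective {s , false} {t , false} (live p) (live q) eq =
    cong (_, false) (trans (sym (β-involutive p)) (trans (cong (λ z → β N (proj₁ z)) eq) (β-involutive q)))

  next-reverse-next : ∀ {x} → Live x → next (reverse (next x)) ≡ reverse x
  next-reverse-next {s , true} (live p) = cong (_, false) (ω-involutive p)
  next-reverse-next {s , false} (live p) = cong (_, true) (β-involutive p)

  next-not-reverse : ∀ {x} → Live x → next x ≢ reverse x
  next-not-reverse {s , true} (live p) eq = ω-not-fixed p (cong proj₁ eq)
  next-not-reverse {s , false} (live p) eq = β-not-fixed p (cong proj₁ eq)

  walk-live : ∀ i {x} → Live x → Live (walk i x)
  walk-live zero l = l
  walk-live (suc i) l = next-live (walk-live i l)

  walk-+ : ∀ i j x → walk (i + j) x ≡ walk i (walk j x)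
  walk-+ zero j x = refl
  walk-+ (suc i) j x = cong next (walk-+ i j x)

  walk-suc : ∀ i x → walk (suc i) x ≡ walk i (next x)
  walk-suc i x = trans (cong (λ k → walk k x) (ℕ.+-comm 1 i)) (walk-+ i 1 x)

  walk-injective : ∀ i {x y} → Live x → Live y → walk i x ≡ walk i y → x ≡ y
  walk-injective zero lx ly eq = eq
  walk-injective (suc i) lx ly eq = walk-injective i lx ly (next-injective (walk-live i lx) (walk-live i ly) eq)

  walk-reverse : ∀ k {x} → Live x → walk k (reverse (walk k x)) ≡ reverse x
  walk-reverse zero l = refl
  walk-reverse (suc k) {x} l = begin
      walk (suc k) (reverse (next (walk k x)))   ≡⟨ walk-suc k _ ⟩
      walk k (next (reverse (next (walk k x))))  ≡⟨ cong (walk k) (next-reverse-next (walk-live k l)) ⟩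
      walk k (reverse (walk k x))                ≡⟨ walk-reverse k l ⟩
      reverse x                                  ∎
    where open ≡-Reasoning

  -- each step flips the direction, so an even walk keeps it
  walk-even-direction : ∀ k x → proj₂ (walk (k + k) x) ≡ proj₂ x
  walk-even-direction zero x = refl
  walk-even-direction (suc k) x rewrite ℕ.+-suc k k with walk (k + k) x | walk-even-direction k x
  ... | (s , true) | eq = eq
  ... | (s , false) | eq = eq

  -- a face boundary never traverses a side in both directions: an even walk
  -- keeps the direction, and an odd walk to the reverse would have a middle
  -- step from a directed side to its own reverse
  no-reversal : ∀ l {x} → Live x → walk l x ≢ reverse x
  no-reversal l {x} lx eq with parity l
  ... | k , inj₁ refl = Bool.not-¬ refl (trans (sym (walk-even-direction k x)) (cong proj₂ eq))
  ... | k , inj₂ refl = next-not-reverse (walk-live k lx)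
          (walk-injective k (next-live (walk-live k lx)) (live (present-side (walk-live k lx))) (begin
            walk k (next (walk k x))  ≡⟨ walk-suc k (walk k x) ⟨
            walk (suc k) (walk k x)   ≡⟨ walk-+ (suc k) k x ⟨
            walk (suc k + k) x        ≡⟨ eq ⟩
            reverse x                 ≡⟨ walk-reverse k lx ⟨
            walk k (reverse (walk k x)) ∎))
    where open ≡-Reasoning

  -- some positive walk returns to its start (pigeonhole on directed sides)
  returns : ∀ {x} → Live x → Σ ℕ λ q → walk (suc q) x ≡ x
  returns {x} lx
    with i , j , i<j , same ← Fin.pigeonhole (ℕ.n<1+n _) (λ i → encode (walk (toℕ i) x))
    with q , j≡ ← ℕ.m≤n⇒∃[o]m+o≡n i<j
    = q , walk-injective (toℕ i) (walk-live (suc q) lx) lx (begin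
        walk (toℕ i) (walk (suc q) x)  ≡⟨ walk-+ (toℕ i) (suc q) x ⟨
        walk (toℕ i + suc q) x         ≡⟨ cong (λ k → walk k x) (trans (ℕ.+-suc (toℕ i) q) j≡) ⟩
        walk (toℕ j) x                 ≡⟨ encode-injective _ _ same ⟨
        walk (toℕ i) x                 ∎)
    where open ≡-Reasoning

  record Period (x : DSide n) : Set where
    field
      q       : ℕ
      closes  : walk (suc q) x ≡ x
      minimal : ∀ j → 0 < j → j < suc q → walk j x ≢ x

  -- the minimal period; abstract, since only its properties are used and
  -- unfolding the search would make typechecking needlessly expensive
  abstract
    period : ∀ {x} → Live x → Period x
    period {x} lx with returns lx
    ... | q₀ , closes₀ with least (λ j → walk (suc j) x ≡ x) (λ j → dside≟ (walk (suc j) x) x) q₀ closes₀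
    ...   | q , _ , closes , below = record { q = q ; closes = closes ; minimal = minimal }
      where
        minimal : ∀ j → 0 < j → j < suc q → walk j x ≢ x
        minimal (suc j) _ (s≤s j<q) = below j j<q

  module Orbit {x : DSide n} (lx : Live x) where
    open Period (period lx) public

    distinct : ∀ i j → i < j → j < suc q → walk i x ≢ walk j x
    distinct i j i<j j<p eq =
      minimal (j ∸ i) (ℕ.m<n⇒0<n∸m i<j) (ℕ.≤-<-trans (ℕ.m∸n≤m j i) j<p)
        (sym (walk-injective i lx (walk-live (j ∸ i) lx) (begin
          walk i x                 ≡⟨ eq ⟩
          walk j x                 ≡⟨ cong (λ k → walk k x) (ℕ.m+[n∸m]≡n (ℕ.<⇒≤ i<j)) ⟨
          walk (i + (j ∸ i)) x     ≡⟨ walk-+ i (j ∸ i) x ⟩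
          walk i (walk (j ∸ i) x)  ∎)))
      where open ≡-Reasoning

    reduce : ∀ i → Σ ℕ λ r → r < suc q × walk i x ≡ walk r x
    reduce zero = 0 , s≤s z≤n , refl
    reduce (suc i) with reduce i
    ... | r , r<p , eq with ℕ.m≤n⇒m<n∨m≡n r<p
    ...   | inj₁ 1+r<p = suc r , 1+r<p , cong next eq
    ...   | inj₂ 1+r≡p = 0 , s≤s z≤n , trans (cong next eq) (trans (cong (λ k → walk k x) 1+r≡p) closes)

    OnOrbit : DSide n → Set
    OnOrbit y = Σ ℕ λ i → walk i x ≡ y

    SideOnOrbit : Side n → Set
    SideOnOrbit v = Σ Bool λ d → OnOrbit (v , d)

    on-orbit-live : ∀ {y} → OnOrbit y → Live y
    on-orbit-live (i , refl) = walk-live i lx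

    predecessor : ∀ {y} → OnOrbit y → Σ (DSide n) λ z → OnOrbit z × next z ≡ y
    predecessor (suc i , eq) = walk i x , (i , refl) , eq
    predecessor (zero , eq) = walk q x , (q , refl) , trans closes eq

    face-step-stays : ∀ {u v} → FStep N u v → SideOnOrbit u → SideOnOrbit v
    face-step-stays (fβ pu refl) (false , i , eq) = true , suc i , cong next eq
    face-step-stays (fω pu refl) (true , i , eq) = false , suc i , cong next eq
    face-step-stays {u} (fβ pu refl) (true , o) with predecessor o
    ... | z , oz , eq = false , subst OnOrbit
          (next-injective (on-orbit-live oz) (live (β-present pu)) (trans eq (cong (_, true) (sym (β-involutive pu))))) oz
    face-step-stays {u} (fω pu refl) (false , o) with predecessor o
    ... | z , oz , eq = true , subst OnOrbit
          (next-injective (on-orbit-live oz) (live (ω-present pu)) (trans eq (cong (_, false) (sym (ω-involutive pu))))) oz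

    same-face-stays : ∀ {u v} → SameFace N u v → SideOnOrbit u → SideOnOrbit v
    same-face-stays [] o = o
    same-face-stays (st ◅ sts) o = same-face-stays sts (face-step-stays st o)

    walk-traversal : ∀ i → Star (TStep N) x (walk i x)
    walk-traversal zero = []
    walk-traversal (suc i) = walk-traversal i ◅◅ (next-step (walk-live i lx) ◅ [])

    on-orbit? : ∀ y → Dec (OnOrbit y)
    on-orbit? y with Fin.any? (λ (r : Fin (suc q)) → dside≟ (walk (toℕ r) x) y)
    ... | yes (r , eq) = yes (toℕ r , eq)
    ... | no none = no λ (i , eq) → let (r , r<p , eq′) = reduce i in
          none (Fin.fromℕ< r<p , trans (cong (λ k → walk k x) (Fin.toℕ-fromℕ< r<p)) (trans (sym eq′) eq))

    side-on-orbit? : ∀ v → Dec (SideOnOrbit v)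
    side-on-orbit? v with on-orbit? (v , true) | on-orbit? (v , false)
    ... | yes o | _ = yes (true , o)
    ... | no _ | yes o = yes (false , o)
    ... | no ¬t | no ¬f = no λ { (true , o) → ¬t o ; (false , o) → ¬f o }

  traversal⇒same-face : ∀ {a b} → Star (TStep N) a b → SameFace N (proj₁ a) (proj₁ b)
  traversal⇒same-face [] = []
  traversal⇒same-face (tω p ◅ ts) = fω p refl ◅ traversal⇒same-face ts
  traversal⇒same-face (tβ p ◅ ts) = fβ p refl ◅ traversal⇒same-face ts

  same-face-sym : ∀ {u v} → SameFace N u v → SameFace N v u
  same-face-sym [] = []
  same-face-sym (fβ p refl ◅ fs) = same-face-sym fs ◅◅ (fβ (β-present p) (sym (β-involutive p)) ◅ [])
  same-face-sym (fω p refl ◅ fs) = same-face-sym fs ◅◅ (fω (ω-present p) (sym (ω-involutive p)) ◅ [])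

  connected-sym : ∀ {u v} → Connected N u v → Connected N v u
  connected-sym [] = []
  connected-sym {u} (viaε p refl ◅ cs) = connected-sym cs ◅◅ (viaε (ε-present {u} p) (sym (ε-involutive u)) ◅ [])
  connected-sym (viaβ p refl ◅ cs) = connected-sym cs ◅◅ (viaβ (β-present p) (sym (β-involutive p)) ◅ [])
  connected-sym (viaω p refl ◅ cs) = connected-sym cs ◅◅ (viaω (ω-present p) (sym (ω-involutive p)) ◅ [])

  same-face⇒connected : ∀ {u v} → SameFace N u v → Connected N u v
  same-face⇒connected [] = []
  same-face⇒connected (fβ p eq ◅ fs) = viaβ p eq ◅ same-face⇒connected fs
  same-face⇒connected (fω p eq ◅ fs) = viaω p eq ◅ same-face⇒connected fs

  -- the sides on the face of u are those traversed by the cycle through (u , true)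
  same-face? : ∀ {u} → Present N u → ∀ v → Dec (SameFace N u v)
  same-face? {u} pu v with Orbit.side-on-orbit? (live {x = (u , true)} pu) v
  ... | yes (d , i , eq) = yes (subst (SameFace N u) (cong proj₁ eq) (traversal⇒same-face (Orbit.walk-traversal (live pu) i)))
  ... | no ¬o = no λ sf → ¬o (Orbit.same-face-stays (live pu) sf (true , 0 , refl))

  -- in a top-degree map the components are the faces, which can be decided
  -- and hence counted
  top-degree-components : TopDegree N → ∀ {s₀} → Present N s₀ → Σ ℕ (Components N)
  top-degree-components td {s₀} p₀ with classify (allSides n) (λ s _ → allSides-complete s) s₀ p₀
    where open FiniteClassification (Present N) (present? N) (SameFace N) (λ a b pa → same-face? pa b)
                                    (λ _ → []) same-face-sym _◅◅_
  ... | k , c , fibres , onto =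
    k , c , (λ s t ps pt → mk⇔ (λ eq → same-face⇒connected (fibres s t ps pt .to eq))
                               (λ st → fibres s t ps pt .from (td s t ps pt st))) , onto

module Deletion {n : ℕ} (N : PMap n) (isM : IsMap N) (e : Fin n) where

  N′ : PMap n
  N′ = delete N e

  present-after : ∀ {s} → Present N′ s → Present N s × proj₁ s ≢ e
  present-after {s} p with present N (proj₁ s) | proj₁ s Fin.≟ e
  ... | true | no s≢e = refl , s≢e
  present-after {s} () | true | yes _
  present-after {s} () | false | _

  present-kept : ∀ {s} → Present N s → proj₁ s ≢ e → Present N′ s
  present-kept {s} p s≢e with present N (proj₁ s) | proj₁ s Fin.≟ e
  ... | true | no _ = refl
  ... | true | yes s≡e = ⊥-elim (s≢e s≡e)
  ... | false | _ = p

  module Rerouted (g : Side n → Side n) (inv : Involution N g) where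
    open Involution inv

    g′ : Side n → Side n
    g′ s = if does (proj₁ (g s) Fin.≟ e) then g (ε (g s)) else g s

    g′-off : ∀ {s} → proj₁ (g s) ≢ e → g′ s ≡ g s
    g′-off {s} gs≢e with proj₁ (g s) Fin.≟ e
    ... | yes gs≡e = ⊥-elim (gs≢e gs≡e)
    ... | no _ = refl

    g′-on : ∀ {s} → proj₁ (g s) ≡ e → g′ s ≡ g (ε (g s))
    g′-on {s} gs≡e with proj₁ (g s) Fin.≟ e
    ... | yes _ = refl
    ... | no gs≢e = ⊥-elim (gs≢e gs≡e)

    rerouted-cases : ∀ s → g′ s ≡ g s ⊎ (proj₁ (g s) ≡ e × g′ s ≡ g (ε (g s)))
    rerouted-cases s with proj₁ (g s) Fin.≟ e
    ... | yes gs≡e = inj₂ (gs≡e , refl)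
    ... | no _ = inj₁ refl

    past-e-off : ∀ {s} → Present N s → proj₁ s ≢ e → proj₁ (g s) ≡ e → proj₁ (g (ε (g s))) ≢ e
    past-e-off {s} p s≢e gs≡e t≡e with same-edge {a = g (ε (g s))} {b = g s} (trans t≡e (sym gs≡e))
    ... | inj₁ t≡gs = s≢e (begin
          proj₁ s                    ≡⟨ cong proj₁ (involutive p) ⟨
          proj₁ (g (g s))            ≡⟨ cong (λ z → proj₁ (g z)) t≡gs ⟨
          proj₁ (g (g (ε (g s))))    ≡⟨ cong proj₁ (involutive (keeps-present p)) ⟩
          proj₁ (ε (g s))            ≡⟨ gs≡e ⟩
          e                          ∎)
      where open ≡-Reasoning
    ... | inj₂ t≡εgs = fixed-point-free (keeps-present p) t≡εgs

    rerouted : Involution N′ g′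
    rerouted = record { keeps-present = keeps ; involutive = invol ; fixed-point-free = not-fixed }
      where
        keeps : ∀ {s} → Present N′ s → Present N′ (g′ s)
        keeps {s} p′ with present-after {s} p′ | proj₁ (g s) Fin.≟ e
        ... | p , s≢e | no gs≢e = present-kept {g s} (keeps-present p) gs≢e
        ... | p , s≢e | yes gs≡e = present-kept {g (ε (g s))} (keeps-present (keeps-present p)) (past-e-off p s≢e gs≡e)
        invol : ∀ {s} → Present N′ s → g′ (g′ s) ≡ s
        invol {s} p′ with present-after {s} p′ | proj₁ (g s) Fin.≟ e
        ... | p , s≢e | no gs≢e = begin
              g′ (g s)  ≡⟨ g′-off (subst (λ z → proj₁ z ≢ e) (sym (involutive p)) s≢e) ⟩
              g (g s)   ≡⟨ involutive p ⟩
              s         ∎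
          where open ≡-Reasoning
        ... | p , s≢e | yes gs≡e = begin
              g′ (g (ε (g s)))          ≡⟨ g′-on (trans (cong proj₁ (involutive (keeps-present p))) gs≡e) ⟩
              g (ε (g (g (ε (g s)))))   ≡⟨ cong (λ z → g (ε z)) (involutive (keeps-present p)) ⟩
              g (ε (ε (g s)))           ≡⟨ cong g (ε-involutive (g s)) ⟩
              g (g s)                   ≡⟨ involutive p ⟩
              s                         ∎
          where open ≡-Reasoning
        not-fixed : ∀ {s} → Present N′ s → g′ s ≢ s
        not-fixed {s} p′ with present-after {s} p′ | proj₁ (g s) Fin.≟ e
        ... | p , s≢e | no gs≢e = fixed-point-free p
        ... | p , s≢e | yes gs≡e = λ t≡s →
              ε-not-fixed (g s) (trans (sym (involutive (keeps-present p))) (cong g t≡s))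

  module Rβ = Rerouted (β N) (β-involution N isM)
  module Rω = Rerouted (ω N) (ω-involution N isM)

  isMap-after : IsMap N′
  isMap-after s p = as-triple Rβ.rerouted p , as-triple Rω.rerouted p
    where
      as-triple : ∀ {g} → Involution N′ g → ∀ {s} → Present N′ s → Present N′ (g s) × g (g s) ≡ s × g s ≢ s
      as-triple r p = Involution.keeps-present r p , Involution.involutive r p , Involution.fixed-point-free r p

module EdgeRemoval {n : ℕ} (N : PMap n) (isM : IsMap N) (e : Fin n) (pe : present N e ≡ true) where
  open Faces N isM
  open Deletion N isM e public
  module F′ = Faces N′ isMap-after

  connected-after⇒before : ∀ {u v} → Connected N′ u v → Connected N u v
  connected-after⇒before [] = []
  connected-after⇒before (st ◅ sts) = step st ◅◅ connected-after⇒before sts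
    where
      step : ∀ {u v} → CStep N′ u v → Connected N u v
      step {u} (viaε p refl) = viaε (proj₁ (present-after {u} p)) refl ◅ []
      step {u} (viaβ p refl) with Rβ.rerouted-cases u | proj₁ (present-after {u} p)
      ... | inj₁ eq | pu = viaβ pu eq ◅ []
      ... | inj₂ (_ , eq) | pu = viaβ pu refl ◅ viaε (β-present pu) refl ◅ viaβ (ε-present {β N u} (β-present pu)) eq ◅ []
      step {u} (viaω p refl) with Rω.rerouted-cases u | proj₁ (present-after {u} p)
      ... | inj₁ eq | pu = viaω pu eq ◅ []
      ... | inj₂ (_ , eq) | pu = viaω pu refl ◅ viaε (ω-present pu) refl ◅ viaω (ε-present {ω N u} (ω-present pu)) eq ◅ []

  -- if both sides of e lie on one face of N, every face walk of N ∖ e is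
  -- one of N: going around e at a corner stays on that face
  module OneFace (e-one-face : SameFace N (e , false) (e , true)) where
    sides-of-e-same-face : ∀ {a b} → proj₁ a ≡ e → proj₁ b ≡ e → SameFace N a b
    sides-of-e-same-face {e , false} {e , false} refl refl = []
    sides-of-e-same-face {e , true} {e , true} refl refl = []
    sides-of-e-same-face {e , false} {e , true} refl refl = e-one-face
    sides-of-e-same-face {e , true} {e , false} refl refl = same-face-sym e-one-face

    same-face-after⇒before : ∀ {u v} → SameFace N′ u v → SameFace N u v
    same-face-after⇒before [] = []
    same-face-after⇒before (st ◅ sts) = step st ◅◅ same-face-after⇒before sts
      where
        step : ∀ {u v} → FStep N′ u v → SameFace N u v
        step {u} (fβ p refl) with Rβ.rerouted-cases u | proj₁ (present-after {u} p)
        ... | inj₁ eq | pu = fβ pu eq ◅ []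
        ... | inj₂ (on-e , eq) | pu = (fβ pu refl ◅ sides-of-e-same-face on-e on-e)
                                    ◅◅ (fβ (ε-present {β N u} (β-present pu)) eq ◅ [])
        step {u} (fω p refl) with Rω.rerouted-cases u | proj₁ (present-after {u} p)
        ... | inj₁ eq | pu = fω pu eq ◅ []
        ... | inj₂ (on-e , eq) | pu = (fω pu refl ◅ sides-of-e-same-face on-e on-e)
                                    ◅◅ (fω (ε-present {ω N u} (ω-present pu)) eq ◅ [])

  Neighbour : Side n → Set
  Neighbour a = Σ Bool λ b → a ≡ β N (e , b) ⊎ a ≡ ω N (e , b)

  NearE : Side n → Set
  NearE s = proj₁ s ≡ e ⊎ (Present N′ s × Σ (Side n) λ a → Neighbour a × Present N′ a × Connected N′ s a)

  step-target-present : ∀ {s t} → CStep N s t → Present N t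
  step-target-present {s} (viaε p refl) = ε-present {s} p
  step-target-present (viaβ p refl) = β-present p
  step-target-present (viaω p refl) = ω-present p

  step-avoiding-e : ∀ {s t} → CStep N s t → proj₁ s ≢ e → proj₁ t ≢ e → CStep N′ s t
  step-avoiding-e {s} (viaε p refl) s≢e t≢e = viaε (present-kept {s} p s≢e) refl
  step-avoiding-e {s} (viaβ p refl) s≢e t≢e = viaβ (present-kept {s} p s≢e) (sym (Rβ.g′-off t≢e))
  step-avoiding-e {s} (viaω p refl) s≢e t≢e = viaω (present-kept {s} p s≢e) (sym (Rω.g′-off t≢e))

  step-leaving-e : ∀ {s t} → CStep N s t → proj₁ s ≡ e → proj₁ t ≢ e → Neighbour t
  step-leaving-e {s} (viaε p refl) s≡e t≢e = ⊥-elim (t≢e s≡e)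
  step-leaving-e {s , b} (viaβ p refl) refl t≢e = b , inj₁ refl
  step-leaving-e {s , b} (viaω p refl) refl t≢e = b , inj₂ refl

  step-entering-e : ∀ {s t} → CStep N s t → proj₁ s ≢ e → proj₁ t ≡ e → Neighbour s
  step-entering-e {s} (viaε p refl) s≢e t≡e = ⊥-elim (s≢e t≡e)
  step-entering-e {s} (viaβ p refl) s≢e refl = proj₂ (β N s) , inj₁ (sym (β-involutive p))
  step-entering-e {s} (viaω p refl) s≢e refl = proj₂ (ω N s) , inj₂ (sym (ω-involutive p))

  SurvivingPath : Side n → Side n → Set
  SurvivingPath s t = Present N′ s × Present N′ t × Connected N′ s t

  split : ∀ {s t} → Present N s → Connected N s t → SurvivingPath s t ⊎ (NearE s × NearE t)
  split {s} ps [] = trivial (proj₁ s Fin.≟ e)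
    where
      trivial : Dec (proj₁ s ≡ e) → SurvivingPath s s ⊎ (NearE s × NearE s)
      trivial (yes s≡e) = inj₂ (inj₁ s≡e , inj₁ s≡e)
      trivial (no s≢e) = inj₁ (present-kept {s} ps s≢e , present-kept {s} ps s≢e , [])
  split {s} {t} ps (_◅_ {j = s₁} st rest) = extend (split (step-target-present st) rest) (proj₁ s Fin.≟ e) (proj₁ s₁ Fin.≟ e)
    where
      extend : SurvivingPath s₁ t ⊎ (NearE s₁ × NearE t) → Dec (proj₁ s ≡ e) → Dec (proj₁ s₁ ≡ e) →
               SurvivingPath s t ⊎ (NearE s × NearE t)
      extend (inj₂ (_ , near-t)) (yes s≡e) _ = inj₂ (inj₁ s≡e , near-t)
      extend (inj₁ (p₁ , pt , c)) (yes s≡e) _ =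
        inj₂ (inj₁ s≡e , inj₂ (pt , s₁ , step-leaving-e st s≡e (proj₂ (present-after {s₁} p₁)) , p₁ , F′.connected-sym c))
      extend (inj₁ (p₁ , _ , _)) (no _) (yes s₁≡e) = ⊥-elim (proj₂ (present-after {s₁} p₁) s₁≡e)
      extend (inj₂ (_ , near-t)) (no s≢e) (yes s₁≡e) =
        inj₂ (inj₂ (present-kept {s} ps s≢e , s , step-entering-e st s≢e s₁≡e , present-kept {s} ps s≢e , []) , near-t)
      extend (inj₁ (p₁ , pt , c)) (no s≢e) (no s₁≢e) = inj₁ (present-kept {s} ps s≢e , pt , step-avoiding-e st s≢e s₁≢e ◅ c)
      extend (inj₂ (inj₁ s₁≡e , _)) (no _) (no s₁≢e) = ⊥-elim (s₁≢e s₁≡e)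
      extend (inj₂ (inj₂ (_ , a , na , pa , c) , near-t)) (no s≢e) (no s₁≢e) =
        inj₂ (inj₂ (present-kept {s} ps s≢e , a , na , pa , step-avoiding-e st s≢e s₁≢e ◅ c) , near-t)

  NeighboursJoined : Set
  NeighboursJoined = ∀ a a′ → Neighbour a → Neighbour a′ → Present N′ a → Present N′ a′ → Connected N′ a a′

  connection-survives : NeighboursJoined → ∀ {s t} → Present N′ s → Present N′ t → Connected N s t → Connected N′ s t
  connection-survives joined {s} {t} ps pt c with split (proj₁ (present-after {s} ps)) c
  ... | inj₁ (_ , _ , c′) = c′
  ... | inj₂ (inj₁ s≡e , _) = ⊥-elim (proj₂ (present-after {s} ps) s≡e)
  ... | inj₂ (_ , inj₁ t≡e) = ⊥-elim (proj₂ (present-after {t} pt) t≡e)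
  ... | inj₂ (inj₂ (_ , a , na , pa , ca) , inj₂ (_ , b , nb , pb , cb)) =
        ca ◅◅ joined a b na nb pa pb ◅◅ F′.connected-sym cb

  top-degree-lift : SameFace N (e , false) (e , true) → TopDegree N′ → TopDegree N
  top-degree-lift e-one-face td′ s t ps pt c with split ps c
  ... | inj₁ (ps′ , pt′ , c′) = same-face-after⇒before (td′ s t ps′ pt′ c′)
    where open OneFace e-one-face
  ... | inj₂ (near-s , near-t) = near⇒e-face near-s ◅◅ same-face-sym (near⇒e-face near-t)
    where
      open OneFace e-one-face
      near⇒e-face : ∀ {x} → NearE x → SameFace N x (e , false)
      near⇒e-face (inj₁ x≡e) = sides-of-e-same-face x≡e refl
      near⇒e-face {x} (inj₂ (px , a , (b , inj₁ refl) , pa , c)) =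
        same-face-after⇒before (td′ x _ px pa c) ◅◅ (fβ (β-present pe) (sym (β-involutive {e , b} pe)) ◅ sides-of-e-same-face refl refl)
      near⇒e-face {x} (inj₂ (px , a , (b , inj₂ refl) , pa , c)) =
        same-face-after⇒before (td′ x _ px pa c) ◅◅ (fω (ω-present pe) (sym (ω-involutive {e , b} pe)) ◅ sides-of-e-same-face refl refl)

  start : DSide n
  start = ((e , false) , true)

  module C = Orbit (live {x = start} pe)

  b₀ w₀ : Side n
  b₀ = β N (e , false)
  w₀ = ω N (e , false)

  walk-last : walk C.q start ≡ (b₀ , false)
  walk-last = next-injective (walk-live C.q (live pe)) (live (β-present pe))
                (trans C.closes (cong (_, true) (sym (β-involutive pe))))

  inside-off-e : ∀ i → 0 < i → i < suc C.q → proj₁ (walk i start) ≢ (e , true) → proj₁ (proj₁ (walk i start)) ≢ e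
  inside-off-e i 0<i i<p not-e₁ on-e = inspect-side (walk i start) refl on-e
    where
      inspect-side : ∀ z → z ≡ walk i start → proj₁ (proj₁ z) ≡ e → ⊥
      inspect-side ((.e , true) , d) z≡ refl = not-e₁ (sym (cong proj₁ z≡))
      inspect-side ((.e , false) , true) z≡ refl = C.minimal i 0<i i<p (sym z≡)
      inspect-side ((.e , false) , false) z≡ refl = no-reversal i (live pe) (sym z≡)

  next-after : ∀ z → proj₁ (proj₁ (next z)) ≢ e → F′.next z ≡ next z
  next-after (s , true) off = cong (_, false) (Rω.g′-off off)
  next-after (s , false) off = cong (_, true) (Rβ.g′-off off)

  present-after-walk : ∀ i → proj₁ (proj₁ (walk i start)) ≢ e → Present N′ (proj₁ (walk i start))
  present-after-walk i off = present-kept {proj₁ (walk i start)} (present-side (walk-live i (live pe))) off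

  stretch : ∀ k → (∀ i → 0 < i → i ≤ suc k → proj₁ (proj₁ (walk i start)) ≢ e) →
            Star (TStep N′) (walk 1 start) (walk (suc k) start)
  stretch zero _ = []
  stretch (suc k) off = stretch k (λ i 0<i i≤ → off i 0<i (ℕ.m≤n⇒m≤1+n i≤)) ◅◅
     (subst (TStep N′ (walk (suc k) start)) (next-after (walk (suc k) start) (off (suc (suc k)) (s≤s z≤n) ℕ.≤-refl))
        (F′.next-step (F′.live (present-after-walk (suc k) (off (suc k) (s≤s z≤n) (ℕ.n≤1+n _))))) ◅ [])

  b₀-joined : Present N′ b₀ → CStep N′ b₀ (β N (e , true))
  b₀-joined pb = viaβ pb (sym (trans (Rβ.g′-on (cong proj₁ (β-involutive pe))) (cong (λ z → β N (ε z)) (β-involutive pe))))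

  w₀-joined : Present N′ w₀ → CStep N′ w₀ (ω N (e , true))
  w₀-joined pw = viaω pw (sym (trans (Rω.g′-on (cong proj₁ (ω-involutive pe))) (cong (λ z → ω N (ε z)) (ω-involutive pe))))

  neighbour-joined : Present N′ b₀ → Present N′ w₀ → ∀ {a} → Neighbour a → Connected N′ a b₀ ⊎ Connected N′ a w₀
  neighbour-joined pb pw (false , inj₁ refl) = inj₁ []
  neighbour-joined pb pw (true , inj₁ refl) = inj₁ (F′.connected-sym (b₀-joined pb ◅ []))
  neighbour-joined pb pw (false , inj₂ refl) = inj₂ []
  neighbour-joined pb pw (true , inj₂ refl) = inj₂ (F′.connected-sym (w₀-joined pw ◅ []))

  one-sided⇒corners-joined : (∀ i → i < suc C.q → proj₁ (walk i start) ≢ (e , true)) →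
                             Present N′ b₀ × Present N′ w₀ × Connected N′ w₀ b₀
  one-sided⇒corners-joined not-e₁ = pb , pw , subst (λ z → Connected N′ w₀ (proj₁ z)) walk-last
      (F′.same-face⇒connected (F′.traversal⇒same-face (subst (Star (TStep N′) (walk 1 start)) q-eq (stretch (C.q ∸ 1) off))))
    where
      q≢0 : C.q ≢ 0
      q≢0 q≡0 = Bool.not-¬ refl (sym (cong proj₂ (trans (cong (λ k → walk (suc k) start) (sym q≡0)) C.closes)))
      0<q : 0 < C.q
      0<q = ℕ.n≢0⇒n>0 q≢0
      1+[q∸1] : suc (C.q ∸ 1) ≡ C.q
      1+[q∸1] = ℕ.suc-pred C.q ⦃ ≢-nonZero q≢0 ⦄
      off : ∀ i → 0 < i → i ≤ suc (C.q ∸ 1) → proj₁ (proj₁ (walk i start)) ≢ e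
      off i 0<i i≤ = inside-off-e i 0<i i<p (not-e₁ i i<p)
        where i<p = s≤s (subst (i ≤_) 1+[q∸1] i≤)
      q-eq : walk (suc (C.q ∸ 1)) start ≡ walk C.q start
      q-eq = cong (λ k → walk k start) 1+[q∸1]
      pw : Present N′ w₀
      pw = present-after-walk 1 (inside-off-e 1 (s≤s z≤n) (s≤s 0<q) (not-e₁ 1 (s≤s 0<q)))
      pb : Present N′ b₀
      pb = subst (λ z → Present N′ (proj₁ z)) walk-last
             (present-after-walk C.q (inside-off-e C.q 0<q (ℕ.n<1+n _) (not-e₁ C.q (ℕ.n<1+n _))))

  -- A bridge has both sides on one face: otherwise the corners of e stay
  -- joined in N ∖ e, no connection is lost, and no component is gained.
  bridge⇒one-face : Bridge N e → SameFace N (e , false) (e , true)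
  bridge⇒one-face (k , k′ , comps , comps′ , k<k′)
    with Fin.any? (λ (r : Fin (suc C.q)) → side≟ (proj₁ (walk (toℕ r) start)) (e , true))
  ... | yes (r , on-face) = subst (SameFace N (e , false)) on-face (traversal⇒same-face (C.walk-traversal (toℕ r)))
  ... | no none = ⊥-elim (ℕ.<⇒≱ k<k′ (fewer-classes (λ {s} p → proj₁ (present-after {s} p)) (λ ps pt → connection-survives joined ps pt) comps comps′))
    where
      not-e₁ : ∀ i → i < suc C.q → proj₁ (walk i start) ≢ (e , true)
      not-e₁ i i<p eq = none (Fin.fromℕ< i<p , trans (cong (λ k → proj₁ (walk k start)) (Fin.toℕ-fromℕ< i<p)) eq)
      corners : Present N′ b₀ × Present N′ w₀ × Connected N′ w₀ b₀
      corners = one-sided⇒corners-joined not-e₁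
      to-w₀ : ∀ {a} → Neighbour a → Connected N′ a w₀
      to-w₀ na with neighbour-joined (proj₁ corners) (proj₁ (proj₂ corners)) na
      ... | inj₁ a~b₀ = a~b₀ ◅◅ F′.connected-sym (proj₂ (proj₂ corners))
      ... | inj₂ a~w₀ = a~w₀
      joined : NeighboursJoined
      joined a a′ na na′ _ _ = to-w₀ na ◅◅ F′.connected-sym (to-w₀ na′)

  Removable : Set
  Removable = Twisted N e ⊎ Bridge N e ⊎ Leaf N e

  removable⇒one-face : Removable → SameFace N (e , false) (e , true)
  removable⇒one-face (inj₁ twisted) = traversal⇒same-face twisted
  removable⇒one-face (inj₂ (inj₁ bridge)) = bridge⇒one-face bridge
  removable⇒one-face (inj₂ (inj₂ (inj₁ black-leaf))) = fβ pe (sym black-leaf) ◅ []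
  removable⇒one-face (inj₂ (inj₂ (inj₂ white-leaf))) = fω pe (sym white-leaf) ◅ []

  -- Walking around the face of (e , false) one meets (e , true)
  -- first at a position m, in the opposite direction; the stretch 1 … m-1
  -- closes up in N ∖ e into the face of w₀, which misses b₀.  So w₀ and b₀
  -- lie on different faces, hence in different components, of N ∖ e, and
  -- the component of w₀ is new.
  module ForcedBridge (td : TopDegree N) (td′ : TopDegree N′)
    (not-black-leaf : b₀ ≢ (e , true)) (not-white-leaf : w₀ ≢ (e , true))
    (not-twisted : ∀ i → i < suc C.q → walk i start ≢ ((e , true) , true)) where

    e₁-on-cycle : Σ ℕ λ r → r < suc C.q × proj₁ (walk r start) ≡ (e , true)
    e₁-on-cycle with C.same-face-stays (td (e , false) (e , true) pe pe (viaε pe refl ◅ [])) (true , 0 , refl)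
    ... | d , i , eq with C.reduce i
    ...   | r , r<p , eq′ = r , r<p , trans (cong proj₁ (sym eq′)) (cong proj₁ eq)

    first-e₁ : Σ ℕ λ m → m ≤ proj₁ e₁-on-cycle × proj₁ (walk m start) ≡ (e , true)
                       × (∀ j → j < m → proj₁ (walk j start) ≢ (e , true))
    first-e₁ = least (λ j → proj₁ (walk j start) ≡ (e , true)) (λ j → side≟ (proj₁ (walk j start)) (e , true))
                     (proj₁ e₁-on-cycle) (proj₂ (proj₂ e₁-on-cycle))

    m : ℕ
    m = proj₁ first-e₁

    m<p : m < suc C.q
    m<p = ℕ.≤-<-trans (proj₁ (proj₂ first-e₁)) (proj₁ (proj₂ e₁-on-cycle))

    at-m : walk m start ≡ ((e , true) , false)
    at-m = direction (walk m start) refl (proj₁ (proj₂ (proj₂ first-e₁)))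
      where
        direction : ∀ z → z ≡ walk m start → proj₁ z ≡ (e , true) → z ≡ ((e , true) , false)
        direction (s , true) z≡ refl = ⊥-elim (not-twisted m m<p (sym z≡))
        direction (s , false) z≡ refl = refl

    -- position 0 is (e , false) and position 1 is w₀, which is not (e , true)
    1<m : 1 < m
    1<m with m | proj₁ (proj₂ (proj₂ first-e₁))
    ... | zero | ()
    ... | suc zero | w₀≡e₁ = ⊥-elim (not-white-leaf w₀≡e₁)
    ... | suc (suc _) | _ = s≤s (s≤s z≤n)

    before-m-off-e : ∀ i → 0 < i → i < m → proj₁ (proj₁ (walk i start)) ≢ e
    before-m-off-e i 0<i i<m = inside-off-e i 0<i (ℕ.<-trans i<m m<p) (proj₂ (proj₂ (proj₂ first-e₁)) i i<m)

    -- in N ∖ e, arriving at (e , true) is replaced by continuing at w₀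
    wraps-to-w₀ : ∀ z → next z ≡ ((e , true) , false) → F′.next z ≡ (w₀ , false)
    wraps-to-w₀ (s , true) eq = cong (_, false) (trans (Rω.g′-on (cong (λ z → proj₁ (proj₁ z)) eq))
                                                       (cong (λ z → ω N (ε (proj₁ z))) eq))

    inner-cycle : ∀ j → Σ ℕ λ i → (0 < i × i < m) × F′.walk j (walk 1 start) ≡ walk i start
    inner-cycle zero = 1 , (s≤s z≤n , 1<m) , refl
    inner-cycle (suc j) with inner-cycle j
    ... | i , (0<i , i<m) , eq with ℕ.m≤n⇒m<n∨m≡n i<m
    ...   | inj₁ 1+i<m = suc i , (s≤s z≤n , 1+i<m) ,
              trans (cong F′.next eq) (next-after (walk i start) (before-m-off-e (suc i) (s≤s z≤n) 1+i<m))
    ...   | inj₂ 1+i≡m = 1 , (s≤s z≤n , 1<m) ,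
              trans (cong F′.next eq) (wraps-to-w₀ (walk i start) (trans (cong (λ k → walk k start) 1+i≡m) at-m))

    w₀-present : Present N′ w₀
    w₀-present = present-after-walk 1 (before-m-off-e 1 (s≤s z≤n) 1<m)

    b₀-present : Present N′ b₀
    b₀-present = present-kept {b₀} (β-present pe) b₀-off-e
      where
        b₀-off-e : proj₁ b₀ ≢ e
        b₀-off-e b₀-on-e with same-edge {a = b₀} {b = (e , false)} b₀-on-e
        ... | inj₁ b₀≡e₀ = β-not-fixed pe b₀≡e₀
        ... | inj₂ b₀≡e₁ = not-black-leaf b₀≡e₁

    -- b₀ sits at position q of the cycle of N, beyond m, so it is not on the
    -- face of w₀ in N ∖ e (nor, by no-reversal, reversed within 1 … m-1)
    corners-apart : ¬ Connected N′ b₀ w₀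
    corners-apart b₀~w₀ with Y.same-face-stays (td′ w₀ b₀ w₀-present b₀-present (F′.connected-sym b₀~w₀)) (false , 0 , refl)
      where module Y = F′.Orbit (F′.live {x = (w₀ , false)} w₀-present)
    ... | d , j , eq with inner-cycle j
    ...   | i , (0<i , i<m) , eq′ = b₀-at-i d (trans (sym eq′) eq)
      where
        i<q : i < C.q
        i<q = ℕ.<-≤-trans i<m (ℕ.<⇒≤pred m<p)
        b₀-at-i : ∀ d → walk i start ≡ (b₀ , d) → ⊥
        b₀-at-i false eq = C.distinct i C.q i<q (ℕ.n<1+n _) (trans eq (sym walk-last))
        b₀-at-i true eq = no-reversal (C.q ∸ i) (walk-live i (live pe)) (begin
            walk (C.q ∸ i) (walk i start)  ≡⟨ walk-+ (C.q ∸ i) i start ⟨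
            walk (C.q ∸ i + i) start       ≡⟨ cong (λ k → walk k start) (ℕ.m∸n+n≡m (ℕ.<⇒≤ i<q)) ⟩
            walk C.q start                 ≡⟨ walk-last ⟩
            (b₀ , false)                   ≡⟨ cong reverse eq ⟨
            reverse (walk i start)         ∎)
          where open ≡-Reasoning

    -- the component of w₀ in N ∖ e is its face, hence decidable
    near-w₀? : ∀ s → Present N′ s → Dec (Connected N′ s w₀)
    near-w₀? s ps with F′.same-face? ps w₀
    ... | yes sf = yes (F′.same-face⇒connected sf)
    ... | no ¬sf = no λ s~w₀ → ¬sf (td′ s w₀ ps w₀-present s~w₀)

    near-e⇒b₀ : ∀ {s} → Present N′ s → ¬ Connected N′ s w₀ → NearE s → Connected N′ s b₀
    near-e⇒b₀ {s} ps _ (inj₁ s≡e) = ⊥-elim (proj₂ (present-after {s} ps) s≡e)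
    near-e⇒b₀ {s} ps ¬s~w₀ (inj₂ (_ , a , na , pa , s~a)) with neighbour-joined b₀-present w₀-present na
    ... | inj₁ a~b₀ = s~a ◅◅ a~b₀
    ... | inj₂ a~w₀ = ⊥-elim (¬s~w₀ (s~a ◅◅ a~w₀))

    survives-away-from-w₀ : ∀ {s t} → Present N′ s → Present N′ t → ¬ Connected N′ s w₀ → ¬ Connected N′ t w₀ →
                            Connected N s t → Connected N′ s t
    survives-away-from-w₀ {s} ps pt ¬s~w₀ ¬t~w₀ s~t with split (proj₁ (present-after {s} ps)) s~t
    ... | inj₁ (_ , _ , s~′t) = s~′t
    ... | inj₂ (near-s , near-t) = near-e⇒b₀ ps ¬s~w₀ near-s ◅◅ F′.connected-sym (near-e⇒b₀ pt ¬t~w₀ near-t)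

    e-joins-b₀ : ∀ {s} → proj₁ s ≡ e → Connected N s b₀
    e-joins-b₀ {e , false} refl = viaβ pe refl ◅ []
    e-joins-b₀ {e , true} refl = viaε pe refl ◅ viaβ pe refl ◅ []

    w₀-joins-b₀ : Connected N w₀ b₀
    w₀-joins-b₀ = viaω (ω-present pe) (sym (ω-involutive pe)) ◅ e-joins-b₀ refl

    away-rep : ∀ {s} → Present N s → Σ (Side n) λ t → Present N′ t × ¬ Connected N′ t w₀ × Connected N s t
    away-rep {s} ps with proj₁ s Fin.≟ e
    ... | yes s≡e = b₀ , b₀-present , corners-apart , e-joins-b₀ s≡e
    ... | no s≢e with near-w₀? s (present-kept {s} ps s≢e)
    ...   | yes s~w₀ = b₀ , b₀-present , corners-apart , connected-after⇒before s~w₀ ◅◅ w₀-joins-b₀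
    ...   | no ¬s~w₀ = s , present-kept {s} ps s≢e , ¬s~w₀ , []

    -- the components of N ∖ e: those of N, with that of w₀ split off
    bridge : Bridge N e
    bridge with top-degree-components td {e , false} pe
    ... | k , comps = k , suc k , comps , split-off comps , ℕ.n<1+n k
      where
        open SplitOffClass (Present N) (Present N′) (present? N′) (λ {s} p → proj₁ (present-after {s} p))
               (Connected N) (Connected N′) connected-after⇒before connected-sym F′.connected-sym _◅◅_
               w₀ w₀-present [] near-w₀? survives-away-from-w₀ away-rep

  top-degree⇒removable : TopDegree N → TopDegree N′ → Removable
  top-degree⇒removable td td′ with side≟ b₀ (e , true) | side≟ w₀ (e , true)
  ... | yes black-leaf | _ = inj₂ (inj₂ (inj₁ black-leaf))
  ... | no _ | yes white-leaf = inj₂ (inj₂ (inj₂ white-leaf))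
  ... | no not-black | no not-white
    with Fin.any? (λ (r : Fin (suc C.q)) → dside≟ (walk (toℕ r) start) ((e , true) , true))
  ...   | yes (r , eq) = inj₁ (subst (Star (TStep N) start) eq (C.walk-traversal (toℕ r)))
  ...   | no none = inj₂ (inj₁ (ForcedBridge.bridge td td′ not-black not-white not-twisted))
    where
      not-twisted : ∀ i → i < suc C.q → walk i start ≢ ((e , true) , true)
      not-twisted i i<p eq = none (Fin.fromℕ< i<p , trans (cong (λ k → walk k start) (Fin.toℕ-fromℕ< i<p)) eq)

  removal-step : TopDegree N′ → (TopDegree N ⇔ Removable)
  removal-step td′ = mk⇔ (λ td → top-degree⇒removable td td′)
                         (λ removable → top-degree-lift (removable⇒one-face removable) td′)

delete-isMap : ∀ {n} (M : PMap n) → IsMap M → ∀ es → IsMap (foldl delete M es)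
delete-isMap M isM [] = isM
delete-isMap M isM (e ∷ es) = delete-isMap (delete M e) (Deletion.isMap-after M isM e) es

absent-stays-absent : ∀ {n} (M : PMap n) es e → present (foldl delete M es) e ≡ true → present M e ≡ true
absent-stays-absent M [] e p = p
absent-stays-absent M (x ∷ xs) e p with present M e | absent-stays-absent (delete M x) xs e p
... | true | _ = refl

deleted-absent : ∀ {n} (M : PMap n) es e → present (foldl delete M es) e ≡ true → e ∉ es
deleted-absent M (x ∷ xs) e p (there e∈xs) = deleted-absent (delete M x) xs e p e∈xs
deleted-absent M (e ∷ xs) e p (here refl) with absent-stays-absent (delete M e) xs e p
... | still-present with present M e | e Fin.≟ e
...   | true | no e≢e = e≢e refl

kept-present : ∀ {n} (M : PMap n) es e → present M e ≡ true → e ∉ es → present (foldl delete M es) e ≡ true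
kept-present M [] e p _ = p
kept-present M (x ∷ xs) e p e∉ = kept-present (delete M x) xs e p′ (λ e∈xs → e∉ (there e∈xs))
  where
    p′ : present (delete M x) e ≡ true
    p′ with e Fin.≟ x | present M e
    ... | yes e≡x | _ = ⊥-elim (e∉ (here e≡x))
    ... | no _ | true = refl

∈-take-tabulate : ∀ {A : Set} {n} (f : Fin n → A) k {x} → x ∈ take k (tabulate f) → Σ (Fin n) λ j → toℕ j < k × x ≡ f j
∈-take-tabulate {n = suc n} f (suc k) (here refl) = Fin.zero , s≤s z≤n , refl
∈-take-tabulate {n = suc n} f (suc k) (there x∈) with ∈-take-tabulate (λ j → f (Fin.suc j)) k x∈
... | j , j<k , x≡ = Fin.suc j , s≤s j<k , x≡

module History {n : ℕ} (M : PMap n) (isM : IsMap M) (all-present : AllPresent M) (h : Fin n ⤖ Fin n) where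
  -- E i is the edge E(i+1) in the order of the history
  E : Fin n → Fin n
  E = Bijection.to h

  stage-isMap : ∀ i → IsMap (stage M h i)
  stage-isMap i = delete-isMap M isM (take i (tabulate E))

  stage-suc : ∀ (i : Fin n) → stage M h (suc (toℕ i)) ≡ delete (stage M h (toℕ i)) (E i)
  stage-suc i = trans (cong (foldl delete M) (List.take-suc-tabulate E i))
                      (List.foldl-∷ʳ delete M (E i) (take (toℕ i) (tabulate E)))

  next-present : ∀ (i : Fin n) → present (stage M h (toℕ i)) (E i) ≡ true
  next-present i = kept-present M (take (toℕ i) (tabulate E)) (E i) (all-present (E i)) earlier-distinct
    where
      earlier-distinct : E i ∉ take (toℕ i) (tabulate E)
      earlier-distinct Ei∈ with ∈-take-tabulate E (toℕ i) Ei∈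
      ... | j , j<i , Ei≡Ej = ℕ.<-irrefl (cong toℕ (sym (Bijection.injective h Ei≡Ej))) j<i

  -- the last stage has no edges, so it is top-degree
  last-stage-top-degree : TopDegree (stage M h n)
  last-stage-top-degree s t ps _ _ = ⊥-elim (deleted-absent M (take n (tabulate E)) (proj₁ s) ps deleted)
    where
      deleted : proj₁ s ∈ take n (tabulate E)
      deleted with Bijection.strictlySurjective h (proj₁ s)
      ... | j , Ej≡s rewrite List.take-all n (tabulate E) (ℕ.≤-reflexive (List.length-tabulate E)) | sym Ej≡s = ∈-tabulate⁺ j

  Removable-at : Fin n → Set
  Removable-at i = Twisted (stage M h (toℕ i)) (E i) ⊎ Bridge (stage M h (toℕ i)) (E i) ⊎ Leaf (stage M h (toℕ i)) (E i)

  removal-at : ∀ (i : Fin n) → TopDegree (stage M h (suc (toℕ i))) → (TopDegree (stage M h (toℕ i)) ⇔ Removable-at i)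
  removal-at i td-next = EdgeRemoval.removal-step (stage M h (toℕ i)) (stage-isMap (toℕ i)) (E i) (next-present i)
                           (subst TopDegree (stage-suc i) td-next)

  all-removable : (∀ i → i ≤ n → TopDegree (stage M h i)) → ∀ i → Removable-at i
  all-removable td i = removal-at i (td (suc (toℕ i)) (Fin.toℕ<n i)) .to (td (toℕ i) (ℕ.<⇒≤ (Fin.toℕ<n i)))

  -- (B) ⇒ (A), downwards from the empty last stage: stage i, where i + d = n
  top-degree-from : (∀ i → Removable-at i) → ∀ d i → i + d ≡ n → TopDegree (stage M h i)
  top-degree-from removable zero i i+0≡n rewrite ℕ.+-identityʳ i | i+0≡n = last-stage-top-degree
  top-degree-from removable (suc d) i i+1+d≡n = subst (λ k → TopDegree (stage M h k)) (Fin.toℕ-fromℕ< i<n)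
      (removal-at j td-next .from (removable j))
    where
      i<n : i < n
      i<n = subst (i <_) i+1+d≡n (ℕ.m<m+n i (s≤s z≤n))
      j : Fin n
      j = Fin.fromℕ< i<n
      td-next : TopDegree (stage M h (suc (toℕ j)))
      td-next = subst (λ k → TopDegree (stage M h (suc k))) (sym (Fin.toℕ-fromℕ< i<n))
                  (top-degree-from removable d (suc i) (trans (sym (ℕ.+-suc i d)) i+1+d≡n))

lemma1p6 : ∀ {n} (M : PMap n) → IsMap M → AllPresent M → (h : Fin n ⤖ Fin n) →
    (∀ (i : ℕ) → i ≤ n → TopDegree (stage M h i))
    ⇔ (∀ (i : Fin n) →
    Twisted (stage M h (toℕ i)) (Bijection.to h i)
    ⊎ Bridge (stage M h (toℕ i)) (Bijection.to h i)
    ⊎ Leaf (stage M h (toℕ i)) (Bijection.to h i))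
lemma1p6 M isM all-present h = mk⇔ all-removable
    (λ removable i i≤n → top-degree-from removable (_ ∸ i) i (ℕ.m+[n∸m]≡n i≤n))
  where open History M isM all-present h
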